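{- If the complete graph $K_9$ is edge-colored with exactly $28$ colors and contains no rainbow $K_5$, then it contains a rainbow subgraph isomorphic to the Turán graph $T_{9,3}$ (that is, $K_{3,3,3}$).
   Context: Edge colorings are arbitrary (not necessarily proper). A subgraph is rainbow if its edges have pairwise distinct colors. $T_{n,r}$ denotes the complete $r$-partite graph on $n$ vertices with part sizes differing by at most one. -}

module Defs where

open import Data.Nat using (ℕ)
open import Data.Fin using (Fin; toℕ)
open import Data.Nat using (_%_)
import Relation.Binary.PropositionalEquality
open import Data.Fin.Properties using ()
open import Data.Product using (Σ; ∃; _×_; _,_; proj₁)
open import Data.Sum using (_⊎_)
open import Relation.Binary.PropositionalEquality using (_≡_)
open import Relation.Nullary using (¬_)
open import Function.Definitions using (Injective)

-- An edge-colouring of the complete graph K_n with colours from Fin m: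
-- a symmetric function on pairs of vertices (values on the diagonal are
-- irrelevant, since K_n has no loops).
record Colouring (n m : ℕ) : Set where
  field
    col : Fin n → Fin n → Fin m
    sym : ∀ u v → col u v ≡ col v u
open Colouring public

-- The colouring uses exactly m colours: every colour of Fin m occurs on an edge.
UsesAllColours : ∀ {n m} → Colouring n m → Set
UsesAllColours {n} {m} c =
  ∀ (k : Fin m) → Σ (Fin n) λ u → Σ (Fin n) λ v → ¬ (u ≡ v) × col c u v ≡ k

record Graph (k : ℕ) : Set₁ where
  field
    Adj : Fin k → Fin k → Set
    Adj-sym : ∀ {a b} → Adj a b → Adj b a
    Adj-irr : ∀ {a} → ¬ Adj a a
open Graph public

SameEdge : ∀ {k} → Fin k → Fin k → Fin k → Fin k → Set
SameEdge a b a' b' = (a ≡ a' × b ≡ b') ⊎ (a ≡ b' × b ≡ a')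

HasRainbowCopy : ∀ {n m k} → Colouring n m → Graph k → Set
HasRainbowCopy {n} {m} {k} c H =
  Σ (Fin k → Fin n) λ φ → Injective _≡_ _≡_ φ ×
    (∀ a b a' b' → Adj H a b → Adj H a' b' →
       col c (φ a) (φ b) ≡ col c (φ a') (φ b') → SameEdge a b a' b')

K : (k : ℕ) → Graph k
K k = record { Adj = λ a b → ¬ (a ≡ b)
             ; Adj-sym = λ p q → p (Relation.Binary.PropositionalEquality.sym q)
             ; Adj-irr = λ p → p Relation.Binary.PropositionalEquality.refl }

part : Fin 9 → ℕ
part i = toℕ i % 3

T933 : Graph 9
T933 = record { Adj = λ a b → ¬ (part a ≡ part b)
              ; Adj-sym = λ p q → p (Relation.Binary.PropositionalEquality.sym q)
              ; Adj-irr = λ p → p Relation.Binary.PropositionalEquality.refl }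

{-# OPTIONS --safe #-}

-- Deleting a vertex v from an edge-coloured Kₙ loses exactly the colours private to v, all of
-- whose edges contain v. A colour is private to at most two vertices, and to two only if it lies
-- on a single edge; call 2 − #owners the deficit of an occurring colour. Averaging over v: if
-- rainbow-K₅-free colourings of Kₙ₋₁ use at most a colours, a rainbow-K₅-free colouring of Kₙ with
-- C colours has (n − 2)·C + Σ deficit ≤ n·a. Colours owned twice never repeat, so when the total
-- deficit is small, five vertices owning no rarely-owned colour span a rainbow K₅. This gives the
-- bounds 1, 3, 6, 9, 13, 17, 22 for n = 2, …, 8, and total deficit at most 2 for 28 colours on K₉.
-- Unless some colour k₀ has no owner this again yields a rainbow K₅. Otherwise every other colour
-- lies on a single edge, every vertex owns exactly 6 colours, and the k₀-edges form a 2-regular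
-- graph in which no 5 vertices span at most one edge. Such a graph has no independent 4-set, so it
-- is three disjoint triangles, and the complete 3-partite graph across them is rainbow.

module Submission where

open import Defs
open import Data.Empty using (⊥; ⊥-elim)
open import Data.Fin using (Fin; zero; suc; punchIn; punchOut; toℕ; fromℕ<; _↑ˡ_; _↑ʳ_)
open import Data.Fin.Properties as Finₚ using (_≟_; any?; all?; ¬∀⟶∃¬)
open import Data.Nat
  using (ℕ; zero; suc; _+_; _*_; _∸_; _≤_; _<_; _≤?_; _%_; _/_; z≤n; s≤s; s≤s⁻¹)
open import Data.Nat.Properties hiding (_≟_)
open import Data.Nat.DivMod using (m%n<n; m<n*o⇒m/o<n; m≡m%n+[m/n]*n)
open import Algebra.Properties.CommutativeMonoid.Sum +-0-commutativeMonoid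
  using (sum; sum-cong-≗; ∑-distrib-+; ∑-comm)
open import Data.Product using (Σ; ∃; _×_; _,_; proj₁; proj₂; uncurry)
open import Data.Sum using (_⊎_; inj₁; inj₂; [_,_]′)
open import Data.Unit using (tt)
open import Data.Vec.Functional using (Vector; _∷_; []; _++_)
open import Data.Vec.Functional.Properties using (lookup-++ˡ; lookup-++ʳ)
open import Data.Fin.Patterns using (0F; 1F; 2F; 3F; 4F; 5F; 6F; 7F)
open import Function using (_∘_)
open import Function.Definitions using (Injective)
open import Level using (0ℓ)
open import Relation.Binary.PropositionalEquality
  using (_≡_; _≢_; refl; trans; cong; cong₂; subst; ≢-sym; module ≡-Reasoning)
  renaming (sym to ≡-sym)
open import Relation.Nullary using (¬_; Dec; yes; no)
open import Relation.Nullary.Decidable as Dec using (_×-dec_; _⊎-dec_; ¬?; decidable-stable)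
open import Relation.Unary using (Pred; Decidable; _∩_; ∁; _⊆_)
open import Relation.Unary.Properties using (U?; ∁?; _∩?_)


private variable
  k m n : ℕ

-- Finite sums and counting

𝟙 : {P : Set} → Dec P → ℕ
𝟙 (yes _) = 1
𝟙 (no _)  = 0

𝟙-yes : {P : Set} (d : Dec P) → P → 𝟙 d ≡ 1
𝟙-yes (yes _) _ = refl
𝟙-yes (no ¬p) p = ⊥-elim (¬p p)

𝟙-no : {P : Set} (d : Dec P) → ¬ P → 𝟙 d ≡ 0
𝟙-no (yes p) ¬p = ⊥-elim (¬p p)
𝟙-no (no _)  _  = refl

𝟙-mono : {P Q : Set} → (P → Q) → (d : Dec P) (e : Dec Q) → 𝟙 d ≤ 𝟙 e
𝟙-mono f (yes p) (yes _) = ≤-refl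
𝟙-mono f (yes p) (no ¬q) = ⊥-elim (¬q (f p))
𝟙-mono f (no _)  _       = z≤n

𝟙-cong : {P Q : Set} → (P → Q) → (Q → P) → (d : Dec P) (e : Dec Q) → 𝟙 d ≡ 𝟙 e
𝟙-cong f g d e = ≤-antisym (𝟙-mono f d e) (𝟙-mono g e d)

𝟙-split : {P Q : Set} (d : Dec P) (e : Dec Q) → 𝟙 d ≡ 𝟙 (d ×-dec e) + 𝟙 (d ×-dec ¬? e)
𝟙-split (yes _) (yes _) = refl
𝟙-split (yes _) (no _)  = refl
𝟙-split (no _)  _       = refl

𝟙-∁ : {P : Set} (d : Dec P) → 𝟙 d + 𝟙 (¬? d) ≡ 1
𝟙-∁ (yes _) = refl
𝟙-∁ (no _)  = refl

sum-mono-≤ : {f g : Vector ℕ n} → (∀ i → f i ≤ g i) → sum f ≤ sum g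
sum-mono-≤ {zero}  _   = z≤n
sum-mono-≤ {suc n} f≤g = +-mono-≤ (f≤g zero) (sum-mono-≤ (λ i → f≤g (suc i)))

sum-const : ∀ a → sum {n} (λ _ → a) ≡ n * a
sum-const {zero}  a = refl
sum-const {suc n} a = cong (a +_) (sum-const {n} a)

sum-*ˡ : ∀ a (f : Vector ℕ n) → sum (λ i → a * f i) ≡ a * sum f
sum-*ˡ {zero}  a f = ≡-sym (*-zeroʳ a)
sum-*ˡ {suc n} a f =
  trans (cong (a * f zero +_) (sum-*ˡ a (λ i → f (suc i)))) (≡-sym (*-distribˡ-+ a (f zero) _))

≤-sum : (f : Vector ℕ n) (i : Fin n) → f i ≤ sum f
≤-sum f zero    = m≤m+n _ _
≤-sum f (suc i) = ≤-trans (≤-sum (λ j → f (suc j)) i) (m≤n+m _ _)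

+-≤-sum : (f : Vector ℕ n) {i j : Fin n} → i ≢ j → f i + f j ≤ sum f
+-≤-sum f {zero}  {zero}  i≢j = ⊥-elim (i≢j refl)
+-≤-sum f {zero}  {suc j} _   = +-monoʳ-≤ (f zero) (≤-sum (λ l → f (suc l)) j)
+-≤-sum f {suc i} {zero}  _   =
  subst (_≤ sum f) (+-comm (f zero) (f (suc i))) (+-monoʳ-≤ (f zero) (≤-sum (λ l → f (suc l)) i))
+-≤-sum f {suc i} {suc j} i≢j =
  ≤-trans (+-≤-sum (λ l → f (suc l)) (λ i≡j → i≢j (cong suc i≡j))) (m≤n+m _ _)

sum-tight : ∀ (f : Vector ℕ n) a → (∀ i → a ≤ f i) → sum f ≤ n * a → ∀ i → f i ≡ a
sum-tight {n} f a a≤f ∑f≤na i = ≤-antisym fi≤a (a≤f i)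
  where
  excess : Vector ℕ n
  excess j = f j ∸ a
  ∑f≡ : sum f ≡ sum excess + n * a
  ∑f≡ = begin
    sum f                           ≡⟨ sum-cong-≗ (λ j → ≡-sym (m∸n+n≡m (a≤f j))) ⟩
    sum (λ j → excess j + a)        ≡⟨ ∑-distrib-+ excess (λ _ → a) ⟩
    sum excess + sum {n} (λ _ → a)  ≡⟨ cong (sum excess +_) (sum-const {n} a) ⟩
    sum excess + n * a              ∎
    where open ≡-Reasoning
  fi≤a : f i ≤ a
  fi≤a = m∸n≡0⇒m≤n (n≤0⇒n≡0 (≤-trans (≤-sum excess i)
           (+-cancelʳ-≤ (n * a) _ 0 (subst (_≤ n * a) ∑f≡ ∑f≤na))))

count : {P : Pred (Fin n) 0ℓ} → Decidable P → ℕ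
count P? = sum λ i → 𝟙 (P? i)

module _ {P Q : Pred (Fin n) 0ℓ} (P? : Decidable P) (Q? : Decidable Q) where

  count-mono : P ⊆ Q → count P? ≤ count Q?
  count-mono P⊆Q = sum-mono-≤ λ i → 𝟙-mono P⊆Q (P? i) (Q? i)

  count-cong : P ⊆ Q → Q ⊆ P → count P? ≡ count Q?
  count-cong P⊆Q Q⊆P = ≤-antisym (count-mono P⊆Q) (sum-mono-≤ λ i → 𝟙-mono Q⊆P (Q? i) (P? i))

  count-split : count P? ≡ count (P? ∩? Q?) + count (P? ∩? ∁? Q?)
  count-split = trans (sum-cong-≗ λ i → 𝟙-split (P? i) (Q? i)) (∑-distrib-+ {n} _ _)

count-U : count {n} U? ≡ n
count-U {n} = trans (sum-const {n} 1) (*-identityʳ n)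

count-∅ : {P : Pred (Fin n) 0ℓ} (P? : Decidable P) → (∀ x → ¬ P x) → count P? ≡ 0
count-∅ {n} P? ∅ =
  trans (sum-cong-≗ λ x → 𝟙-no (P? x) (∅ x)) (trans (sum-const {n} 0) (*-zeroʳ n))

∈⇒1≤count : {P : Pred (Fin n) 0ℓ} (P? : Decidable P) {x : Fin n} → P x → 1 ≤ count P?
∈⇒1≤count P? {x} Px = ≤-trans (≤-reflexive (≡-sym (𝟙-yes (P? x) Px))) (≤-sum _ x)

𝟙-any≤count : {P : Pred (Fin n) 0ℓ} (P? : Decidable P) → 𝟙 (any? P?) ≤ count P?
𝟙-any≤count P? with any? P?
... | yes (x , Px) = ∈⇒1≤count P? Px
... | no _         = z≤n

module _ {P : Pred (Fin n) 0ℓ} (P? : Decidable P) where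

  count-∁ : count P? + count (∁? P?) ≡ n
  count-∁ = begin
    count P? + count (∁? P?)             ≡⟨ ∑-distrib-+ {n} _ _ ⟨
    sum (λ i → 𝟙 (P? i) + 𝟙 (¬? (P? i))) ≡⟨ sum-cong-≗ (λ i → 𝟙-∁ (P? i)) ⟩
    sum {n} (λ _ → 1)                    ≡⟨ sum-const {n} 1 ⟩
    n * 1                                ≡⟨ *-identityʳ n ⟩
    n                                    ∎
    where open ≡-Reasoning

  count-positive : 1 ≤ count P? → ∃ P
  count-positive = go P?
    where
    go : ∀ {n} {P : Pred (Fin n) 0ℓ} (P? : Decidable P) → 1 ≤ count P? → ∃ P
    go {suc n} P? 1≤count with P? zero
    ... | yes p = zero , p
    ... | no _  = let (i , p) = go (λ i → P? (suc i)) 1≤count in suc i , p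

count-singleton : (a : Fin n) → count (_≟ a) ≡ 1
count-singleton {suc n} zero = cong suc (trans
  (sum-cong-≗ {n} λ i → 𝟙-no (suc i ≟ zero) λ ()) (trans (sum-const {n} 0) (*-zeroʳ n)))
count-singleton {suc n} (suc a) = trans
  (sum-cong-≗ {n} λ i → 𝟙-cong Finₚ.suc-injective (cong suc) (suc i ≟ suc a) (i ≟ a))
  (count-singleton a)

count-pair : (a b : Fin n) → count (λ x → (x ≟ a) ⊎-dec (x ≟ b)) ≤ 2
count-pair a b = begin
  count pair?
    ≡⟨ count-split pair? (_≟ a) ⟩
  count (pair? ∩? (_≟ a)) + count (pair? ∩? ∁? (_≟ a))
    ≤⟨ +-mono-≤ (count-mono _ (_≟ a) proj₂) (count-mono _ (_≟ b) is-b) ⟩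
  count (_≟ a) + count (_≟ b)
    ≡⟨ cong₂ _+_ (count-singleton a) (count-singleton b) ⟩
  2 ∎
  where
  open ≤-Reasoning
  pair? : Decidable λ x → x ≡ a ⊎ x ≡ b
  pair? x = (x ≟ a) ⊎-dec (x ≟ b)
  is-b : ∀ {x} → (x ≡ a ⊎ x ≡ b) × x ≢ a → x ≡ b
  is-b (inj₁ x≡a , x≢a) = ⊥-elim (x≢a x≡a)
  is-b (inj₂ x≡b , _)   = x≡b

count-remove : {P : Pred (Fin n) 0ℓ} (P? : Decidable P) {y : Fin n} → P y →
               count P? ≡ suc (count (P? ∩? ∁? (_≟ y)))
count-remove P? {y} Py = begin
  count P?                                       ≡⟨ count-split P? (_≟ y) ⟩
  count (P? ∩? (_≟ y)) + count (P? ∩? ∁? (_≟ y)) ≡⟨ cong (_+ count (P? ∩? ∁? (_≟ y))) at-y ⟩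
  1 + count (P? ∩? ∁? (_≟ y))                    ∎
  where
  open ≡-Reasoning
  at-y : count (P? ∩? (_≟ y)) ≡ 1
  at-y = trans (count-cong (P? ∩? (_≟ y)) (_≟ y) proj₂ (λ { refl → Py , refl })) (count-singleton y)

count-≢ : (v : Fin (suc n)) → count (∁? (_≟ v)) ≡ n
count-≢ {n} v = suc-injective (begin
  suc (count (∁? (_≟ v)))
    ≡⟨ cong suc (count-cong (∁? (_≟ v)) (U? ∩? ∁? (_≟ v)) (tt ,_) proj₂) ⟩
  suc (count (U? ∩? ∁? (_≟ v)))
    ≡⟨ count-remove U? {v} tt ⟨
  count {suc n} U?
    ≡⟨ count-U ⟩
  suc n ∎)
  where open ≡-Reasoning

count-injection : {P : Pred (Fin m) 0ℓ} {Q : Pred (Fin n) 0ℓ}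
  (P? : Decidable P) (Q? : Decidable Q) (f : ∀ i → P i → Fin n) →
  (∀ i p → Q (f i p)) → (∀ i j p q → f i p ≡ f j q → i ≡ j) → count P? ≤ count Q?
count-injection {zero}  P? Q? f f∈Q f-inj = z≤n
count-injection {suc m} P? Q? f f∈Q f-inj with P? zero
... | no _   = count-injection (λ i → P? (suc i)) Q? (λ i → f (suc i)) (λ i → f∈Q (suc i))
                 (λ i j p q e → Finₚ.suc-injective (f-inj _ _ p q e))
... | yes p₀ = subst (suc _ ≤_) (≡-sym (count-remove Q? (f∈Q zero p₀))) (s≤s
                 (count-injection (λ i → P? (suc i)) (Q? ∩? ∁? (_≟ f zero p₀))
                   (λ i → f (suc i)) (λ i p → f∈Q (suc i) p , λ e → suc≢zero (f-inj _ _ _ _ e))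
                   (λ i j p q e → Finₚ.suc-injective (f-inj _ _ p q e))))
  where
  suc≢zero : ∀ {i : Fin m} → suc i ≢ zero
  suc≢zero ()

∷-injective : {f : Fin k → Fin n} {x : Fin n} → (∀ i → f i ≢ x) → Injective _≡_ _≡_ f →
              Injective _≡_ _≡_ (x ∷ f)
∷-injective x∉f f-inj {zero}  {zero}  _ = refl
∷-injective x∉f f-inj {zero}  {suc j} e = ⊥-elim (x∉f j (≡-sym e))
∷-injective x∉f f-inj {suc i} {zero}  e = ⊥-elim (x∉f i e)
∷-injective x∉f f-inj {suc i} {suc j} e = cong suc (f-inj e)

module _ {P : Pred (Fin n) 0ℓ} (P? : Decidable P) where

  injection⇒≤count : (f : Fin k → Fin n) → Injective _≡_ _≡_ f → (∀ i → P (f i)) →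
                     k ≤ count P?
  injection⇒≤count f f-inj f∈P = subst (_≤ count P?) count-U
    (count-injection U? P? (λ i _ → f i) (λ i _ → f∈P i) (λ i j _ _ → f-inj))

  ≤count⇒injection : k ≤ count P? →
                     Σ (Fin k → Fin n) λ f → Injective _≡_ _≡_ f × ∀ i → P (f i)
  ≤count⇒injection = go P?
    where
    go : ∀ {k} {P : Pred (Fin n) 0ℓ} (P? : Decidable P) → k ≤ count P? →
         Σ (Fin k → Fin n) λ f → Injective _≡_ _≡_ f × ∀ i → P (f i)
    go {zero}  P? _        = [] , (λ {}) , λ ()
    go {suc k} P? k<count  with count-positive P? (≤-trans (s≤s z≤n) k<count)
    ... | y , Py with go (P? ∩? ∁? (_≟ y)) (s≤s⁻¹ (subst (suc k ≤_) (count-remove P? Py) k<count))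
    ... | f , f-inj , f∈P = y ∷ f , ∷-injective (λ i → proj₂ (f∈P i)) f-inj ,
                            λ { zero → Py ; (suc i) → proj₁ (f∈P i) }

  2≤count : {a b : Fin n} → a ≢ b → P a → P b → 2 ≤ count P?
  2≤count {a} {b} a≢b Pa Pb = injection⇒≤count (a ∷ b ∷ [])
    (∷-injective (λ { zero b≡a → a≢b (≡-sym b≡a) ; (suc ()) }) (∷-injective (λ ()) λ {}))
    λ { zero → Pa ; (suc zero) → Pb }

record ExactlyTwo (P : Pred (Fin n) 0ℓ) : Set where
  field
    fst snd : Fin n
    fst≢snd : fst ≢ snd
    P-fst   : P fst
    P-snd   : P snd
    only    : ∀ {x} → P x → x ≡ fst ⊎ x ≡ snd

  other : ∀ {a} → P a → ∃ λ b → ∀ {x} → P x → x ≡ a ⊎ x ≡ b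
  other Pa with only Pa
  ... | inj₁ refl = snd , only
  ... | inj₂ refl = fst , λ Px → [ inj₂ , inj₁ ]′ (only Px)

count≡2⇒exactlyTwo : {P : Pred (Fin n) 0ℓ} (P? : Decidable P) → count P? ≡ 2 → ExactlyTwo P
count≡2⇒exactlyTwo {P = P} P? count≡2 =
  from-pair (≤count⇒injection P? (≤-reflexive (≡-sym count≡2)))
  where
  0≢1 : 0F ≢ 1F
  0≢1 ()
  from-pair : (Σ (Fin 2 → Fin _) λ f → Injective _≡_ _≡_ f × ∀ i → P (f i)) → ExactlyTwo P
  from-pair (f , f-inj , f∈P) = record
    { fst = f 0F ; snd = f 1F ; fst≢snd = 0≢1 ∘ f-inj ; P-fst = f∈P 0F ; P-snd = f∈P 1F
    ; only = only }
    where
    no-third : ∀ {x} → P x → (∀ i → f i ≢ x) → ⊥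
    no-third Px x∉f = <⇒≱ (≤ᵇ⇒≤ 3 3 tt) (subst (3 ≤_) count≡2
      (injection⇒≤count P? (_ ∷ f) (∷-injective x∉f f-inj) λ { 0F → Px ; (suc i) → f∈P i }))
    only : ∀ {x} → P x → x ≡ f 0F ⊎ x ≡ f 1F
    only {x} Px = decidable-stable ((x ≟ f 0F) ⊎-dec (x ≟ f 1F)) λ neither →
      no-third Px λ { 0F e → neither (inj₁ (≡-sym e)) ; 1F e → neither (inj₂ (≡-sym e)) }

Image : (Fin k → Fin n) → Pred (Fin n) 0ℓ
Image f x = ∃ λ i → f i ≡ x

image? : (f : Fin k → Fin n) → Decidable (Image f)
image? f x = any? λ i → f i ≟ x

count-image : (f : Fin k → Fin n) → count (image? f) ≤ k
count-image {k} f = subst (count (image? f) ≤_) count-U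
  (count-injection (image? f) U? (λ _ → proj₁) (λ _ _ → tt)
    λ { x y (i , refl) (j , refl) refl → refl })

count-outside-image : (f : Fin k → Fin n) → n ≤ k + count (∁? (image? f))
count-outside-image {n = n} f = begin
  n                                              ≡⟨ count-∁ (image? f) ⟨
  count (image? f) + count (∁? (image? f))       ≤⟨ +-monoˡ-≤ _ (count-image f) ⟩
  _ + count (∁? (image? f))                      ∎
  where open ≤-Reasoning

fresh : (f : Fin k → Fin n) → k < n → ∃ λ x → ∀ i → f i ≢ x
fresh {k} f k<n =
  let (x , x∉f) = count-positive (∁? (image? f)) (+-cancelˡ-≤ k _ _ k+1≤) in x , λ i e → x∉f (i , e)
  where
  open ≤-Reasoning
  k+1≤ : k + 1 ≤ k + count (∁? (image? f))
  k+1≤ = begin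
    k + 1                      ≡⟨ +-comm k 1 ⟩
    suc k                      ≤⟨ k<n ⟩
    _                          ≤⟨ count-outside-image f ⟩
    k + count (∁? (image? f))  ∎

-- Private colours

_─_ : Colouring (suc n) m → Fin (suc n) → Colouring n m
c ─ v = record { col = λ x y → col c (punchIn v x) (punchIn v y)
               ; sym = λ x y → sym c (punchIn v x) (punchIn v y) }

RainbowK5 : Colouring n m → Set
RainbowK5 c = HasRainbowCopy c (K 5)

rainbow-─ : {H : Graph k} (c : Colouring (suc n) m) (v : Fin (suc n)) →
            HasRainbowCopy (c ─ v) H → HasRainbowCopy c H
rainbow-─ c v (φ , φ-inj , rainbow) =
  (λ i → punchIn v (φ i)) , (λ e → φ-inj (Finₚ.punchIn-injective v _ _ e)) , rainbow

SameEdge-injective : {φ : Fin k → Fin n} → Injective _≡_ _≡_ φ → ∀ {a b a' b'} →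
                     SameEdge (φ a) (φ b) (φ a') (φ b') → SameEdge a b a' b'
SameEdge-injective φ-inj (inj₁ (p , q)) = inj₁ (φ-inj p , φ-inj q)
SameEdge-injective φ-inj (inj₂ (p , q)) = inj₂ (φ-inj p , φ-inj q)

SameEdge-via : {x y x' y' a b : Fin n} → SameEdge x y a b → SameEdge x' y' a b → SameEdge x y x' y'
SameEdge-via (inj₁ (refl , refl)) (inj₁ (refl , refl)) = inj₁ (refl , refl)
SameEdge-via (inj₁ (refl , refl)) (inj₂ (refl , refl)) = inj₂ (refl , refl)
SameEdge-via (inj₂ (refl , refl)) (inj₁ (refl , refl)) = inj₂ (refl , refl)
SameEdge-via (inj₂ (refl , refl)) (inj₂ (refl , refl)) = inj₁ (refl , refl)

adjacent-images-distinct : (H : Graph k) {φ : Fin k → Fin n} → Injective _≡_ _≡_ φ →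
                           ∀ {a b} → Adj H a b → φ a ≢ φ b
adjacent-images-distinct H φ-inj ab p with φ-inj p
... | refl = Adj-irr H ab

Occurs : Colouring n m → Pred (Fin m) 0ℓ
Occurs {n} c k = Σ (Fin n) λ u → Σ (Fin n) λ v → ¬ u ≡ v × col c u v ≡ k

occurs? : (c : Colouring n m) → Decidable (Occurs c)
occurs? c k = any? λ u → any? λ v → ¬? (u ≟ v) ×-dec (col c u v ≟ k)

#colours : Colouring n m → ℕ
#colours c = count (occurs? c)

#colours-all : (c : Colouring n m) → UsesAllColours c → #colours c ≡ m
#colours-all c all-occur = trans (count-cong (occurs? c) U? _ (λ {k} _ → all-occur k)) count-U

occurs-─ : (c : Colouring (suc n) m) (v : Fin (suc n)) → Occurs (c ─ v) ⊆ Occurs c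
occurs-─ c v (x , y , x≢y , e) =
  punchIn v x , punchIn v y , (λ p → x≢y (Finₚ.punchIn-injective v x y p)) , e

Private : Colouring (suc n) m → Fin (suc n) → Pred (Fin m) 0ℓ
Private c v = Occurs c ∩ ∁ (Occurs (c ─ v))

private? : (c : Colouring (suc n) m) (v : Fin (suc n)) → Decidable (Private c v)
private? c v = occurs? c ∩? ∁? (occurs? (c ─ v))

#private : Colouring (suc n) m → Fin (suc n) → ℕ
#private c v = count (private? c v)

owners : Colouring (suc n) m → Fin m → ℕ
owners c k = count λ v → private? c v k

deficit : Colouring (suc n) m → Fin m → ℕ
deficit c k = 2 * 𝟙 (occurs? c k) ∸ owners c k

#colours-─ : (c : Colouring (suc n) m) (v : Fin (suc n)) → #colours c ≡ #colours (c ─ v) + #private c v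
#colours-─ c v = trans (count-split (occurs? c) (occurs? (c ─ v)))
  (cong (_+ #private c v) (count-cong (occurs? c ∩? occurs? (c ─ v)) (occurs? (c ─ v))
    proj₂ λ occ → occurs-─ c v occ , occ))

private-edge : (c : Colouring (suc n) m) {v : Fin (suc n)} {k : Fin m} → Private c v k →
               ∀ {x y} → x ≢ y → col c x y ≡ k → x ≡ v ⊎ y ≡ v
private-edge c {v} (_ , ¬occ) {x} {y} x≢y e with x ≟ v | y ≟ v
... | yes x≡v | _       = inj₁ x≡v
... | no _    | yes y≡v = inj₂ y≡v
... | no x≢v  | no y≢v  = ⊥-elim (¬occ (punchOut v≢x , punchOut v≢y ,
        (λ p → x≢y (Finₚ.punchOut-injective v≢x v≢y p)) ,
        trans (cong₂ (col c) (Finₚ.punchIn-punchOut v≢x) (Finₚ.punchIn-punchOut v≢y)) e))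
  where
  v≢x : v ≢ x
  v≢x p = x≢v (≡-sym p)
  v≢y : v ≢ y
  v≢y p = y≢v (≡-sym p)

owners≤2 : (c : Colouring (suc n) m) (k : Fin m) → owners c k ≤ 2 * 𝟙 (occurs? c k)
owners≤2 c k = by-occurrence (occurs? c k)
  where
  by-occurrence : (d : Dec (Occurs c k)) → owners c k ≤ 2 * 𝟙 d
  by-occurrence (no ¬occ) = ≤-reflexive (count-∅ (λ v → private? c v k) λ v → ¬occ ∘ proj₁)
  by-occurrence (yes (a , b , a≢b , e)) = ≤-trans
    (count-mono (λ v → private? c v k) (λ x → (x ≟ a) ⊎-dec (x ≟ b))
      λ p → [ inj₁ ∘ ≡-sym , inj₂ ∘ ≡-sym ]′ (private-edge c p a≢b e))
    (count-pair a b)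

deficit-unowned : (c : Colouring (suc n) m) {k : Fin m} → Occurs c k → owners c k ≡ 0 →
                  deficit c k ≡ 2
deficit-unowned c {k} occ unowned = cong₂ (λ o w → 2 * o ∸ w) (𝟙-yes (occurs? c k) occ) unowned

owned-if-deficit≤1 : (c : Colouring (suc n) m) {k : Fin m} → deficit c k ≤ 1 → Occurs c k →
                     1 ≤ owners c k
owned-if-deficit≤1 c {k} deficit≤1 occ =
  positive (owners c k) (subst (λ o → 2 * o ∸ owners c k ≤ 1) (𝟙-yes (occurs? c k) occ) deficit≤1)
  where
  positive : ∀ q → 2 ∸ q ≤ 1 → 1 ≤ q
  positive zero    (s≤s ())
  positive (suc q) _ = s≤s z≤n

sum-#private+sum-deficit : (c : Colouring (suc n) m) → sum (#private c) + sum (deficit c) ≡ 2 * #colours c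
sum-#private+sum-deficit c = begin
  sum (#private c) + sum (deficit c)   ≡⟨ cong (_+ sum (deficit c)) (∑-comm λ v → 𝟙 ∘ private? c v) ⟩
  sum (owners c) + sum (deficit c)     ≡⟨ ∑-distrib-+ (owners c) (deficit c) ⟨
  sum (λ k → owners c k + deficit c k) ≡⟨ sum-cong-≗ (λ k → m+[n∸m]≡n (owners≤2 c k)) ⟩
  sum (λ k → 2 * 𝟙 (occurs? c k))      ≡⟨ sum-*ˡ 2 (λ k → 𝟙 (occurs? c k)) ⟩
  2 * #colours c                       ∎
  where open ≡-Reasoning

edge-between-owners : (c : Colouring (suc n) m) {k : Fin m} {a b : Fin (suc n)} → a ≢ b →
  Private c a k → Private c b k → ∀ {x y} → x ≢ y → col c x y ≡ k → SameEdge x y a b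
edge-between-owners c {a = a} {b} a≢b a-owns b-owns {x} {y} x≢y e =
  ends (private-edge c a-owns x≢y e) (private-edge c b-owns x≢y e)
  where
  ends : x ≡ a ⊎ y ≡ a → x ≡ b ⊎ y ≡ b → SameEdge x y a b
  ends (inj₁ p) (inj₁ q) = ⊥-elim (a≢b (trans (≡-sym p) q))
  ends (inj₁ p) (inj₂ q) = inj₁ (p , q)
  ends (inj₂ p) (inj₁ q) = inj₂ (q , p)
  ends (inj₂ p) (inj₂ q) = ⊥-elim (a≢b (trans (≡-sym p) q))

owned-twice⇒single-edge : (c : Colouring (suc n) m) {k : Fin m} → 2 ≤ owners c k →
  ∀ {x y x' y'} → x ≢ y → x' ≢ y' → col c x y ≡ k → col c x' y' ≡ k → SameEdge x y x' y'
owned-twice⇒single-edge c {k} 2≤owners {x} {y} {x'} {y'} x≢y x'≢y' e e' =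
  via-owners (≤count⇒injection (λ v → private? c v k) 2≤owners)
  where
  0≢1 : 0F ≢ 1F
  0≢1 ()
  via-owners : (Σ (Fin 2 → Fin _) λ f → Injective _≡_ _≡_ f × ∀ i → Private c (f i) k) →
               SameEdge x y x' y'
  via-owners (f , f-inj , f-owns) =
    SameEdge-via (edge-between-owners c (0≢1 ∘ f-inj) (f-owns 0F) (f-owns 1F) x≢y e)
                 (edge-between-owners c (0≢1 ∘ f-inj) (f-owns 0F) (f-owns 1F) x'≢y' e')

rainbow-of-owned-twice : {H : Graph k} (c : Colouring (suc n) m) (φ : Fin k → Fin (suc n)) →
  Injective _≡_ _≡_ φ → (∀ a b → Adj H a b → 2 ≤ owners c (col c (φ a) (φ b))) →
  HasRainbowCopy c H
rainbow-of-owned-twice {H = H} c φ φ-inj owned-twice = φ , φ-inj , λ a b a' b' ab a'b' e →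
  SameEdge-injective φ-inj (owned-twice⇒single-edge c (owned-twice a b ab)
    (adjacent-images-distinct H φ-inj ab) (adjacent-images-distinct H φ-inj a'b') refl (≡-sym e))

single-edge-colours : (c : Colouring (suc n) m) {k₀ k : Fin m} → sum (deficit c) ≤ 2 →
  Occurs c k₀ → owners c k₀ ≡ 0 → Occurs c k → k ≢ k₀ → 2 ≤ owners c k
single-edge-colours c {k₀} {k} deficit≤2 occ₀ unowned occ k≢k₀ =
  m∸n≡0⇒m≤n (trans (cong (λ o → 2 * o ∸ owners c k) (≡-sym (𝟙-yes (occurs? c k) occ)))
    (n≤0⇒n≡0 (+-cancelʳ-≤ 2 _ 0 (begin
      deficit c k + 2            ≡⟨ cong (deficit c k +_) (deficit-unowned c occ₀ unowned) ⟨
      deficit c k + deficit c k₀ ≤⟨ +-≤-sum (deficit c) k≢k₀ ⟩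
      sum (deficit c)            ≤⟨ deficit≤2 ⟩
      2                          ∎))))
  where open ≤-Reasoning

RareOwner : Colouring (suc n) m → Pred (Fin (suc n)) 0ℓ
RareOwner c v = ∃ λ k → owners c k ≤ 1 × Private c v k

rareOwner? : (c : Colouring (suc n) m) → Decidable (RareOwner c)
rareOwner? c v = any? λ k → (owners c k ≤? 1) ×-dec private? c v k

m≤2b∸m : ∀ {m b} → m ≤ 1 → m ≤ 2 * b → m ≤ 2 * b ∸ m
m≤2b∸m {zero}              _   _  = z≤n
m≤2b∸m {suc zero} {suc b}  _   _  = ≤-trans (s≤s z≤n) (m≤n+m _ b)
m≤2b∸m {suc (suc _)} (s≤s ())

count-rareOwner : (c : Colouring (suc n) m) → count (rareOwner? c) ≤ sum (deficit c)
count-rareOwner c = begin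
  count (rareOwner? c)                 ≤⟨ sum-mono-≤ (λ v → 𝟙-any≤count (λ k → rare k v)) ⟩
  sum (λ v → sum (λ k → 𝟙 (rare k v))) ≡⟨ ∑-comm (λ v k → 𝟙 (rare k v)) ⟩
  sum (λ k → count (rare k))           ≤⟨ sum-mono-≤ (λ k → rare-owners≤deficit k (owners c k ≤? 1)) ⟩
  sum (deficit c)                      ∎
  where
  open ≤-Reasoning
  rare : ∀ k → Decidable λ v → owners c k ≤ 1 × Private c v k
  rare k v = (owners c k ≤? 1) ×-dec private? c v k
  rare-owners≤deficit : ∀ k (d : Dec (owners c k ≤ 1)) → count (λ v → d ×-dec private? c v k) ≤ deficit c k
  rare-owners≤deficit k (no ≰1) =
    ≤-trans (≤-reflexive (count-∅ (λ v → no ≰1 ×-dec private? c v k) λ _ → ≰1 ∘ proj₁)) z≤n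
  rare-owners≤deficit k (yes ≤1) = begin
    count (λ v → yes ≤1 ×-dec private? c v k)
      ≡⟨ count-cong (λ v → yes ≤1 ×-dec private? c v k) (λ v → private? c v k) proj₂ (≤1 ,_) ⟩
    owners c k
      ≤⟨ m≤2b∸m {b = 𝟙 (occurs? c k)} ≤1 (owners≤2 c k) ⟩
    deficit c k ∎

owned-twice-off-rareOwners : (c : Colouring (suc n) m) → (∀ k → Occurs c k → 1 ≤ owners c k) →
  ∀ {x y} → x ≢ y → ¬ RareOwner c x → ¬ RareOwner c y → 2 ≤ owners c (col c x y)
owned-twice-off-rareOwners c owned {x} {y} x≢y x-ok y-ok = ≰⇒> not-rare
  where
  not-rare : ¬ owners c (col c x y) ≤ 1
  not-rare rare = an-owner-is-an-end
    (count-positive (λ v → private? c v (col c x y)) (owned _ (x , y , x≢y , refl)))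
    where
    an-owner-is-an-end : ∃ (λ v → Private c v (col c x y)) → ⊥
    an-owner-is-an-end (v , v-owns) =
      [ (λ x≡v → x-ok (subst (RareOwner c) (≡-sym x≡v) (_ , rare , v-owns)))
      , (λ y≡v → y-ok (subst (RareOwner c) (≡-sym y≡v) (_ , rare , v-owns))) ]′
      (private-edge c v-owns x≢y refl)

-- Every occurring colour has an owner and there are at most Σ deficit rare owners, so an edge
-- avoiding them all carries a colour owned twice.
rainbowK5-of-small-deficit : (c : Colouring (suc n) m) → (∀ k → Occurs c k → 1 ≤ owners c k) →
                             sum (deficit c) + 5 ≤ suc n → RainbowK5 c
rainbowK5-of-small-deficit {n} c owned small =
  from-five (≤count⇒injection (∁? (rareOwner? c)) five-ordinary)
  where
  open ≤-Reasoning
  five-ordinary : 5 ≤ count (∁? (rareOwner? c))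
  five-ordinary = +-cancelˡ-≤ (sum (deficit c)) _ _ (begin
    sum (deficit c) + 5                                   ≤⟨ small ⟩
    suc n                                                 ≡⟨ count-∁ (rareOwner? c) ⟨
    count (rareOwner? c) + count (∁? (rareOwner? c))      ≤⟨ +-monoˡ-≤ _ (count-rareOwner c) ⟩
    sum (deficit c) + count (∁? (rareOwner? c))           ∎)
  from-five : (Σ (Fin 5 → Fin (suc n)) λ φ → Injective _≡_ _≡_ φ × ∀ i → ¬ RareOwner c (φ i))
              → RainbowK5 c
  from-five (φ , φ-inj , φ-ordinary) = rainbow-of-owned-twice {H = K 5} c φ φ-inj λ a b a≢b →
    owned-twice-off-rareOwners c owned (a≢b ∘ φ-inj) (φ-ordinary a) (φ-ordinary b)

-- Colour bounds for colourings without a rainbow K₅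

ColourBound : ℕ → ℕ → ℕ → Set
ColourBound m n a = (c : Colouring n m) → ¬ RainbowK5 c → #colours c ≤ a

colour-averaging : ∀ {a} → ColourBound m n a → (c : Colouring (suc n) m) → ¬ RainbowK5 c →
                   suc n * #colours c ≤ sum (#private c) + suc n * a
colour-averaging {n = n} {a} bound c ¬rainbow = begin
  suc n * #colours c                              ≡⟨ sum-const {suc n} (#colours c) ⟨
  sum {suc n} (λ v → #colours c)                  ≡⟨ sum-cong-≗ (λ v → trans (#colours-─ c v)
                                                       (+-comm (#colours (c ─ v)) (#private c v))) ⟩
  sum (λ v → #private c v + #colours (c ─ v))     ≤⟨ sum-mono-≤ (λ v → +-monoʳ-≤ (#private c v)
                                                       (bound (c ─ v) (¬rainbow-─ v))) ⟩
  sum (λ v → #private c v + a)                    ≡⟨ ∑-distrib-+ (#private c) (λ _ → a) ⟩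
  sum (#private c) + sum {suc n} (λ _ → a)        ≡⟨ cong (sum (#private c) +_) (sum-const {suc n} a) ⟩
  sum (#private c) + suc n * a                    ∎
  where
  open ≤-Reasoning
  ¬rainbow-─ : ∀ v → ¬ RainbowK5 (c ─ v)
  ¬rainbow-─ v r = ¬rainbow (rainbow-─ {H = K 5} c v r)

deficit-bound : ∀ {a} → ColourBound m (2 + n) a → (c : Colouring (3 + n) m) → ¬ RainbowK5 c →
                suc n * #colours c + sum (deficit c) ≤ (3 + n) * a
deficit-bound {n = n} {a} bound c ¬rainbow = +-cancelˡ-≤ (2 * C) _ _ (begin
  2 * C + (suc n * C + D)   ≡⟨ +-assoc (2 * C) _ _ ⟨
  (2 * C + suc n * C) + D   ≡⟨ cong (_+ D) (*-distribʳ-+ C 2 (suc n)) ⟨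
  (3 + n) * C + D           ≤⟨ +-monoˡ-≤ D (colour-averaging bound c ¬rainbow) ⟩
  (P + (3 + n) * a) + D     ≡⟨ +-assoc P _ D ⟩
  P + ((3 + n) * a + D)     ≡⟨ cong (P +_) (+-comm _ D) ⟩
  P + (D + (3 + n) * a)     ≡⟨ +-assoc P D _ ⟨
  (P + D) + (3 + n) * a     ≡⟨ cong (_+ (3 + n) * a) (sum-#private+sum-deficit c) ⟩
  2 * C + (3 + n) * a       ∎)
  where
  open ≤-Reasoning
  C P D : ℕ
  C = #colours c
  P = sum (#private c)
  D = sum (deficit c)

#private-balanced : ∀ {a p} → ColourBound m n a → (c : Colouring (suc n) m) → ¬ RainbowK5 c →
  #colours c ≡ a + p → sum (#private c) ≤ suc n * p → ∀ v → #private c v ≡ p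
#private-balanced {a = a} {p} bound c ¬rainbow #colours≡ ∑≤ = sum-tight (#private c) p p≤ ∑≤
  where
  p≤ : ∀ v → p ≤ #private c v
  p≤ v = +-cancelˡ-≤ a _ _ (begin
    a + p                          ≡⟨ #colours≡ ⟨
    #colours c                     ≡⟨ #colours-─ c v ⟩
    #colours (c ─ v) + #private c v ≤⟨ +-monoˡ-≤ (#private c v)
                                         (bound (c ─ v) λ r → ¬rainbow (rainbow-─ {H = K 5} c v r)) ⟩
    a + #private c v               ∎)
    where open ≤-Reasoning

bound-step : ∀ {a b} → ColourBound m (2 + n) a → (3 + n) * a < suc n * suc b → ColourBound m (3 + n) b
bound-step {n = n} {a} {b} bound lt c ¬rainbow =
  decidable-stable (#colours c ≤? b) λ ≰b → <⇒≱ lt (begin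
  suc n * suc b                     ≤⟨ *-monoʳ-≤ (suc n) (≰⇒> ≰b) ⟩
  suc n * #colours c                ≤⟨ m≤m+n _ _ ⟩
  suc n * #colours c + sum (deficit c) ≤⟨ deficit-bound bound c ¬rainbow ⟩
  (3 + n) * a                       ∎)
  where open ≤-Reasoning

bound-step-rainbow : ∀ {a b t} → ColourBound m (2 + n) a → (3 + n) * a ≤ suc n * suc b + t →
                     t ≤ 1 → t + 5 ≤ 3 + n → ColourBound m (3 + n) b
bound-step-rainbow {n = n} {a} {b} {t} bound le t≤1 t+5≤ c ¬rainbow =
  decidable-stable (#colours c ≤? b) λ ≰b → ¬rainbow (rainbowK5-of-small-deficit c
  (λ k → owned-if-deficit≤1 c (≤-trans (≤-sum (deficit c) k) (≤-trans (deficit≤t ≰b) t≤1)))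
  (≤-trans (+-monoˡ-≤ 5 (deficit≤t ≰b)) t+5≤))
  where
  open ≤-Reasoning
  deficit≤t : ¬ #colours c ≤ b → sum (deficit c) ≤ t
  deficit≤t ≰b = +-cancelˡ-≤ (suc n * suc b) _ _ (begin
    suc n * suc b + sum (deficit c)      ≤⟨ +-monoˡ-≤ _ (*-monoʳ-≤ (suc n) (≰⇒> ≰b)) ⟩
    suc n * #colours c + sum (deficit c) ≤⟨ deficit-bound bound c ¬rainbow ⟩
    (3 + n) * a                          ≤⟨ le ⟩
    suc n * suc b + t                    ∎)

-- For n ≥ 5 these are the anti-Ramsey numbers ar(n, K₅) = t₃(n) + 1, with t₃(n) the number of
-- edges of the Turán graph Tₙ,₃.
bound₂ : ColourBound m 2 1
bound₂ c _ = ≤-trans (count-mono (occurs? c) (_≟ col c zero (suc zero)) the-edge)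
                     (≤-reflexive (count-singleton (col c zero (suc zero))))
  where
  the-edge : ∀ {k} → Occurs c k → k ≡ col c zero (suc zero)
  the-edge (zero     , zero     , 0≢0 , _) = ⊥-elim (0≢0 refl)
  the-edge (zero     , suc zero , _   , e) = ≡-sym e
  the-edge (suc zero , zero     , _   , e) = trans (≡-sym e) (sym c _ _)
  the-edge (suc zero , suc zero , 1≢1 , _) = ⊥-elim (1≢1 refl)

bound₃ : ColourBound m 3 3
bound₃ = bound-step bound₂ (≤ᵇ⇒≤ _ _ tt)

bound₄ : ColourBound m 4 6
bound₄ = bound-step bound₃ (≤ᵇ⇒≤ _ _ tt)

bound₅ : ColourBound m 5 9
bound₅ = bound-step-rainbow {t = 0} bound₄ (≤ᵇ⇒≤ _ _ tt) z≤n ≤-refl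

bound₆ : ColourBound m 6 13
bound₆ = bound-step bound₅ (≤ᵇ⇒≤ _ _ tt)

bound₇ : ColourBound m 7 17
bound₇ = bound-step-rainbow {t = 1} bound₆ (≤ᵇ⇒≤ _ _ tt) ≤-refl (≤ᵇ⇒≤ _ _ tt)

bound₈ : ColourBound m 8 22
bound₈ = bound-step bound₇ (≤ᵇ⇒≤ _ _ tt)

-- The extremal colourings of K₉

K₉-deficit≤2 : (c : Colouring 9 m) → #colours c ≡ 28 → ¬ RainbowK5 c → sum (deficit c) ≤ 2
K₉-deficit≤2 c #colours≡28 ¬rainbow = +-cancelˡ-≤ 196 (sum (deficit c)) 2
  (subst (λ C → 7 * C + sum (deficit c) ≤ 198) #colours≡28 (deficit-bound bound₈ c ¬rainbow))

K₉-#private≡6 : (c : Colouring 9 m) → #colours c ≡ 28 → ¬ RainbowK5 c → ∀ {k₀} →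
                Occurs c k₀ → owners c k₀ ≡ 0 → ∀ v → #private c v ≡ 6
K₉-#private≡6 c #colours≡28 ¬rainbow {k₀} occ₀ unowned =
  #private-balanced bound₈ c ¬rainbow #colours≡28 (+-cancelʳ-≤ 2 (sum (#private c)) 54 (begin
    sum (#private c) + 2               ≡⟨ cong (sum (#private c) +_) (deficit-unowned c occ₀ unowned) ⟨
    sum (#private c) + deficit c k₀    ≤⟨ +-monoʳ-≤ (sum (#private c)) (≤-sum (deficit c) k₀) ⟩
    sum (#private c) + sum (deficit c) ≡⟨ sum-#private+sum-deficit c ⟩
    2 * #colours c                     ≡⟨ cong (2 *_) #colours≡28 ⟩
    56                                 ∎))
  where open ≤-Reasoning

part<3 : ∀ i → part i < 3
part<3 i = m%n<n (toℕ i) 3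

layer<3 : ∀ (i : Fin 9) → toℕ i / 3 < 3
layer<3 i = m<n*o⇒m/o<n {n = 3} (Finₚ.toℕ<n i)

part′ : Fin 9 → Fin 3
part′ i = fromℕ< (part<3 i)

layer : Fin 9 → Fin 3
layer i = fromℕ< (layer<3 i)

toℕ-part′ : ∀ i → toℕ (part′ i) ≡ part i
toℕ-part′ i = Finₚ.toℕ-fromℕ< (part<3 i)

toℕ-layer : ∀ i → toℕ (layer i) ≡ toℕ i / 3
toℕ-layer i = Finₚ.toℕ-fromℕ< (layer<3 i)

part′-layer-injective : ∀ {i j} → part′ i ≡ part′ j → layer i ≡ layer j → i ≡ j
part′-layer-injective {i} {j} p q = Finₚ.toℕ-injective (begin
  toℕ i                      ≡⟨ m≡m%n+[m/n]*n (toℕ i) 3 ⟩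
  part i + toℕ i / 3 * 3     ≡⟨ cong₂ (λ r d → r + d * 3) (via-toℕ toℕ-part′ p) (via-toℕ toℕ-layer q) ⟩
  part j + toℕ j / 3 * 3     ≡⟨ m≡m%n+[m/n]*n (toℕ j) 3 ⟨
  toℕ j                      ∎)
  where
  open ≡-Reasoning
  via-toℕ : ∀ {f : Fin 9 → Fin 3} {g : Fin 9 → ℕ} → (∀ i → toℕ (f i) ≡ g i) →
            f i ≡ f j → g i ≡ g j
  via-toℕ toℕ-f e = trans (≡-sym (toℕ-f i)) (trans (cong toℕ e) (toℕ-f j))

module Extremal (c : Colouring 9 m) (k₀ : Fin m) (¬rainbow : ¬ RainbowK5 c)
                (k₀-unowned : owners c k₀ ≡ 0) (single : ∀ k → k ≢ k₀ → 2 ≤ owners c k)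
                (#private≡6 : ∀ v → #private c v ≡ 6) where

  infix 4 _~_ _~?_

  _~_ : Fin 9 → Fin 9 → Set
  x ~ y = x ≢ y × col c x y ≡ k₀

  _~?_ : ∀ x → Decidable (x ~_)
  x ~? y = ¬? (x ≟ y) ×-dec (col c x y ≟ k₀)

  ~-sym : ∀ {x y} → x ~ y → y ~ x
  ~-sym {x} {y} (x≢y , e) = (λ p → x≢y (≡-sym p)) , trans (sym c y x) e

  ~-irrefl : ∀ {x} → ¬ x ~ x
  ~-irrefl (x≢x , _) = x≢x refl

  equal-colours : ∀ {x y x' y'} → x ≢ y → x' ≢ y' → col c x y ≡ col c x' y' →
                  SameEdge x y x' y' ⊎ (x ~ y × x' ~ y')
  equal-colours {x} {y} {x'} {y'} x≢y x'≢y' e = by-colour (col c x y ≟ k₀)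
    where
    by-colour : Dec (col c x y ≡ k₀) → SameEdge x y x' y' ⊎ (x ~ y × x' ~ y')
    by-colour (yes e₀) = inj₂ ((x≢y , e₀) , (x'≢y' , trans (≡-sym e) e₀))
    by-colour (no ≢k₀) =
      inj₁ (owned-twice⇒single-edge c (single (col c x y) ≢k₀) x≢y x'≢y' refl (≡-sym e))

  rainbow-if-k₀-edges-agree : (H : Graph k) (φ : Fin k → Fin 9) → Injective _≡_ _≡_ φ →
    (∀ {a b a' b'} → Adj H a b → Adj H a' b' → φ a ~ φ b → φ a' ~ φ b' → SameEdge a b a' b') →
    HasRainbowCopy c H
  rainbow-if-k₀-edges-agree H φ φ-inj agree = φ , φ-inj , λ a b a' b' ab a'b' e →
    [ SameEdge-injective φ-inj , (λ (p , q) → agree ab a'b' p q) ]′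
      (equal-colours (adjacent-images-distinct H φ-inj ab) (adjacent-images-distinct H φ-inj a'b') e)

  degree : Fin 9 → ℕ
  degree v = count (v ~?_)

  PlainNeighbour : Fin 9 → Pred (Fin 9) 0ℓ
  PlainNeighbour v x = x ≢ v × col c v x ≢ k₀

  plainNeighbour? : ∀ v → Decidable (PlainNeighbour v)
  plainNeighbour? v x = ¬? (x ≟ v) ×-dec ¬? (col c v x ≟ k₀)

  degree+plain≡8 : ∀ v → degree v + count (plainNeighbour? v) ≡ 8
  degree+plain≡8 v = begin
    degree v + count (plainNeighbour? v)
      ≡⟨ cong (_+ count (plainNeighbour? v)) (count-cong (v ~?_) others-k₀ to from) ⟩
    count others-k₀ + count (plainNeighbour? v)
      ≡⟨ count-split (∁? (_≟ v)) (λ x → col c v x ≟ k₀) ⟨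
    count (∁? (_≟ v))
      ≡⟨ count-≢ v ⟩
    8 ∎
    where
    open ≡-Reasoning
    others-k₀ : Decidable λ x → x ≢ v × col c v x ≡ k₀
    others-k₀ = ∁? (_≟ v) ∩? (λ x → col c v x ≟ k₀)
    to : ∀ {x} → v ~ x → x ≢ v × col c v x ≡ k₀
    to (v≢x , e) = (λ p → v≢x (≡-sym p)) , e
    from : ∀ {x} → x ≢ v × col c v x ≡ k₀ → v ~ x
    from (x≢v , e) = (λ p → x≢v (≡-sym p)) , e

  private-spoke : ∀ {v k} → Private c v k → ∃ λ z → z ≢ v × col c v z ≡ k
  private-spoke {v} {k} p@((x , y , x≢y , e) , _) = [ via-x , via-y ]′ (private-edge c p x≢y e)
    where
    via-x : x ≡ v → ∃ λ z → z ≢ v × col c v z ≡ k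
    via-x x≡v = y , (λ y≡v → x≢y (trans x≡v (≡-sym y≡v))) ,
                subst (λ t → col c t y ≡ k) x≡v e
    via-y : y ≡ v → ∃ λ z → z ≢ v × col c v z ≡ k
    via-y y≡v = x , (λ x≡v → x≢y (trans x≡v (≡-sym y≡v))) ,
                trans (sym c v x) (subst (λ t → col c x t ≡ k) y≡v e)

  k₀-not-private : ∀ {v} → ¬ Private c v k₀
  k₀-not-private p = <⇒≱ (∈⇒1≤count (λ v → private? c v k₀) p) (≤-reflexive k₀-unowned)

  #private≤plain : ∀ v → #private c v ≤ count (plainNeighbour? v)
  #private≤plain v = count-injection (private? c v) (plainNeighbour? v)
    (λ _ p → proj₁ (private-spoke p))
    (λ _ p → let (z , z≢v , e) = private-spoke p in
             z≢v , λ e₀ → k₀-not-private (subst (Private c v) (trans (≡-sym e) e₀) p))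
    (λ _ _ p p' z≡z' → let (_ , _ , e) = private-spoke p ; (_ , _ , e') = private-spoke p' in
                        trans (≡-sym e) (trans (cong (col c v) z≡z') e'))

  plain≤#private : ∀ v → count (plainNeighbour? v) ≤ #private c v
  plain≤#private v = count-injection (plainNeighbour? v) (private? c v) (λ x _ → col c v x)
    (λ x (x≢v , ≢k₀) → (v , x , v≢ x≢v , refl) , λ (y , z , y≢z , e) →
      lies-off-v (owned-twice⇒single-edge c (single _ ≢k₀) (v≢ x≢v)
        (λ p → y≢z (Finₚ.punchIn-injective v y z p)) refl e))
    (λ x x' (x≢v , ≢k₀) (x'≢v , _) e →
      [ proj₂ , (λ (v≡x' , _) → ⊥-elim (x'≢v (≡-sym v≡x'))) ]′
        (owned-twice⇒single-edge c (single _ ≢k₀) (v≢ x≢v) (v≢ x'≢v) refl (≡-sym e)))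
    where
    v≢ : ∀ {x} → x ≢ v → v ≢ x
    v≢ x≢v p = x≢v (≡-sym p)
    lies-off-v : ∀ {x y z} → ¬ SameEdge v x (punchIn v y) (punchIn v z)
    lies-off-v (inj₁ (p , _)) = Finₚ.punchInᵢ≢i v _ (≡-sym p)
    lies-off-v (inj₂ (p , _)) = Finₚ.punchInᵢ≢i v _ (≡-sym p)

  -- The colours owned by v are exactly those of its edges not coloured k₀.
  degree≡2 : ∀ v → degree v ≡ 2
  degree≡2 v =
    +-cancelʳ-≡ 6 (degree v) 2 (trans (cong (degree v +_) (≡-sym plain≡6)) (degree+plain≡8 v))
    where
    plain≡6 : count (plainNeighbour? v) ≡ 6
    plain≡6 = trans (≤-antisym (plain≤#private v) (#private≤plain v)) (#private≡6 v)

  neighbours : ∀ v → ExactlyTwo (v ~_)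
  neighbours v = count≡2⇒exactlyTwo (v ~?_) (degree≡2 v)

  Independent : (Fin k → Fin 9) → Set
  Independent ψ = ∀ i j → ¬ ψ i ~ ψ j

  ∷-independent : {ψ : Fin k → Fin 9} {x : Fin 9} → (∀ i → ¬ x ~ ψ i) → Independent ψ →
                  Independent (x ∷ ψ)
  ∷-independent x≁ψ ψ-indep zero    zero    = ~-irrefl
  ∷-independent x≁ψ ψ-indep zero    (suc j) = x≁ψ j
  ∷-independent x≁ψ ψ-indep (suc i) zero    = x≁ψ i ∘ ~-sym
  ∷-independent x≁ψ ψ-indep (suc i) (suc j) = ψ-indep i j

  apex-edge : {ψ : Fin k → Fin 9} {z : Fin 9} → Independent ψ →
              ∀ {a b} → (z ∷ ψ) a ~ (z ∷ ψ) b → ∃ λ t → z ~ ψ t × SameEdge a b zero (suc t)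
  apex-edge ψ-indep {zero}  {zero}  p = ⊥-elim (~-irrefl p)
  apex-edge ψ-indep {zero}  {suc t} p = t , p , inj₁ (refl , refl)
  apex-edge ψ-indep {suc t} {zero}  p = t , ~-sym p , inj₂ (refl , refl)
  apex-edge ψ-indep {suc i} {suc j} p = ⊥-elim (ψ-indep i j p)

  apex-has-two-neighbours : (ψ : Fin 4 → Fin 9) → Injective _≡_ _≡_ ψ → Independent ψ →
                            ∀ {z} → (∀ i → ψ i ≢ z) → 2 ≤ count (λ i → z ~? ψ i)
  apex-has-two-neighbours ψ ψ-inj ψ-indep {z} z∉ψ = ≰⇒> λ ≤1 →
    ¬rainbow (rainbow-if-k₀-edges-agree (K 5) (z ∷ ψ) (∷-injective z∉ψ ψ-inj) (agree ≤1))
    where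
    unique : count (λ i → z ~? ψ i) ≤ 1 → ∀ {t t'} → z ~ ψ t → z ~ ψ t' → t ≡ t'
    unique ≤1 {t} {t'} p p' = decidable-stable (t ≟ t') λ t≢t' →
      <⇒≱ (2≤count (λ i → z ~? ψ i) t≢t' p p') ≤1
    agree : count (λ i → z ~? ψ i) ≤ 1 → ∀ {a b a' b'} → a ≢ b → a' ≢ b' →
            (z ∷ ψ) a ~ (z ∷ ψ) b → (z ∷ ψ) a' ~ (z ∷ ψ) b' → SameEdge a b a' b'
    agree ≤1 {a' = a'} {b'} _ _ p p' =
      let (t , q , ab) = apex-edge ψ-indep p ; (t' , q' , a'b') = apex-edge ψ-indep p' in
      SameEdge-via ab (subst (λ s → SameEdge a' b' zero (suc s)) (≡-sym (unique ≤1 q q')) a'b')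

  -- Each of the five vertices outside ψ has two k₀-neighbours in ψ, but ψ has total degree 8.
  no-independent-4-set : (ψ : Fin 4 → Fin 9) → Injective _≡_ _≡_ ψ → ¬ Independent ψ
  no-independent-4-set ψ ψ-inj ψ-indep = <⇒≱ (≤ᵇ⇒≤ 9 10 tt) (begin
    2 * 5                                            ≤⟨ *-monoʳ-≤ 2 five-outside ⟩
    2 * count outside?                               ≡⟨ sum-*ˡ 2 (λ z → 𝟙 (outside? z)) ⟨
    sum (λ z → 2 * 𝟙 (outside? z))                    ≤⟨ sum-mono-≤ (λ z → apex (outside? z)) ⟩
    sum (λ z → count (λ i → z ~? ψ i))                ≡⟨ ∑-comm (λ z i → 𝟙 (z ~? ψ i)) ⟩
    sum (λ i → count (λ z → z ~? ψ i))                ≡⟨ sum-cong-≗ (λ i →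
                                                          count-cong (λ z → z ~? ψ i) (ψ i ~?_) ~-sym ~-sym) ⟩
    sum (λ i → degree (ψ i))                         ≡⟨ sum-cong-≗ (λ i → degree≡2 (ψ i)) ⟩
    8                                                ∎)
    where
    open ≤-Reasoning
    outside? : Decidable (∁ (Image ψ))
    outside? = ∁? (image? ψ)
    five-outside : 5 ≤ count outside?
    five-outside = +-cancelˡ-≤ 4 5 _ (count-outside-image ψ)
    apex : ∀ {z} (d : Dec (¬ Image ψ z)) → 2 * 𝟙 d ≤ count (λ i → z ~? ψ i)
    apex (yes z∉ψ) = apex-has-two-neighbours ψ ψ-inj ψ-indep λ i e → z∉ψ (i , e)
    apex (no _)    = z≤n

  ¬~-outside : ∀ {u a b t} → (∀ {x} → u ~ x → x ≡ a ⊎ x ≡ b) → a ≢ t → b ≢ t → ¬ u ~ t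
  ¬~-outside only a≢t b≢t u~t = [ a≢t ∘ ≡-sym , b≢t ∘ ≡-sym ]′ (only u~t)

  -- If x ≁ z, then x, z and two vertices chosen away from their neighbourhoods would form an
  -- independent 4-set.
  ~-trans : ∀ {x y z} → x ~ y → y ~ z → x ≢ z → x ~ z
  ~-trans {x} {y} {z} x~y y~z x≢z = decidable-stable (x ~? z) λ x≁z →
    let (r , r∉) = fresh avoid-r (≤ᵇ⇒≤ 6 9 tt)
        (s , s∉) = fresh (avoid-s r) (≤ᵇ⇒≤ 9 9 tt)
    in
    no-independent-4-set (x ∷ z ∷ r ∷ s ∷ []) (injective r∉ s∉) (independent x≁z r∉ s∉)
    where
    x-other : ∃ λ x' → ∀ {t} → x ~ t → t ≡ y ⊎ t ≡ x'
    x-other = ExactlyTwo.other (neighbours x) x~y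
    z-other : ∃ λ z' → ∀ {t} → z ~ t → t ≡ y ⊎ t ≡ z'
    z-other = ExactlyTwo.other (neighbours z) (~-sym y~z)
    x' z' : Fin 9
    x' = proj₁ x-other
    z' = proj₁ z-other
    x-only : ∀ {t} → x ~ t → t ≡ y ⊎ t ≡ x'
    x-only = proj₂ x-other
    z-only : ∀ {t} → z ~ t → t ≡ y ⊎ t ≡ z'
    z-only = proj₂ z-other
    avoid-r : Fin 5 → Fin 9
    avoid-r = x ∷ z ∷ y ∷ x' ∷ z' ∷ []
    avoid-s : Fin 9 → Fin 8 → Fin 9
    avoid-s r = x ∷ z ∷ y ∷ x' ∷ z' ∷ r ∷ fst ∷ snd ∷ []
      where open ExactlyTwo (neighbours r)
    injective : ∀ {r s} → (∀ i → avoid-r i ≢ r) → (∀ i → avoid-s r i ≢ s) →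
                Injective _≡_ _≡_ (x ∷ z ∷ r ∷ s ∷ [])
    injective {r} {s} r∉ s∉ =
      ∷-injective {f = z ∷ r ∷ s ∷ []}
        (λ { 0F → ≢-sym x≢z ; 1F → ≢-sym (r∉ 0F) ; 2F → ≢-sym (s∉ 0F) })
        (∷-injective {f = r ∷ s ∷ []} (λ { 0F → ≢-sym (r∉ 1F) ; 1F → ≢-sym (s∉ 1F) })
          (∷-injective {f = s ∷ []} (λ { 0F → ≢-sym (s∉ 5F) })
            (∷-injective {f = []} (λ ()) λ {})))
    independent : ¬ x ~ z → ∀ {r s} → (∀ i → avoid-r i ≢ r) → (∀ i → avoid-s r i ≢ s) →
                  Independent (x ∷ z ∷ r ∷ s ∷ [])
    independent x≁z {r} {s} r∉ s∉ =
      ∷-independent {ψ = z ∷ r ∷ s ∷ []} (λ { 0F → x≁z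
                                            ; 1F → ¬~-outside x-only (r∉ 2F) (r∉ 3F)
                                            ; 2F → ¬~-outside x-only (s∉ 2F) (s∉ 3F) })
        (∷-independent {ψ = r ∷ s ∷ []} (λ { 0F → ¬~-outside z-only (r∉ 2F) (r∉ 4F)
                                          ; 1F → ¬~-outside z-only (s∉ 2F) (s∉ 4F) })
          (∷-independent {ψ = s ∷ []}
            (λ { 0F → ¬~-outside (ExactlyTwo.only (neighbours r)) (s∉ 6F) (s∉ 7F) })
            (∷-independent {ψ = []} (λ ()) λ ())))

  infix 4 _≈_

  _≈_ : Fin 9 → Fin 9 → Set
  x ≈ y = x ≡ y ⊎ x ~ y

  ≈-sym : ∀ {x y} → x ≈ y → y ≈ x
  ≈-sym (inj₁ x≡y) = inj₁ (≡-sym x≡y)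
  ≈-sym (inj₂ x~y) = inj₂ (~-sym x~y)

  ≈-trans : ∀ {x y z} → x ≈ y → y ≈ z → x ≈ z
  ≈-trans (inj₁ refl) y≈z        = y≈z
  ≈-trans (inj₂ x~y)  (inj₁ refl) = inj₂ x~y
  ≈-trans {x} {z = z} (inj₂ x~y) (inj₂ y~z) =
    [ inj₁ , (λ x≢z → inj₂ (~-trans x~y y~z x≢z)) ]′ (Dec.toSum (x ≟ z))

  member : Fin 9 → Fin 3 → Fin 9
  member t = t ∷ fst ∷ snd ∷ []
    where open ExactlyTwo (neighbours t)

  ≈-member : ∀ t j → t ≈ member t j
  ≈-member t 0F = inj₁ refl
  ≈-member t 1F = inj₂ (ExactlyTwo.P-fst (neighbours t))
  ≈-member t 2F = inj₂ (ExactlyTwo.P-snd (neighbours t))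

  member-injective : ∀ t → Injective _≡_ _≡_ (member t)
  member-injective t = ∷-injective {f = fst ∷ snd ∷ []}
    (λ { 0F → ≢-sym (proj₁ P-fst) ; 1F → ≢-sym (proj₁ P-snd) })
    (∷-injective {f = snd ∷ []} (λ { 0F → ≢-sym fst≢snd }) (∷-injective {f = []} (λ ()) λ {}))
    where open ExactlyTwo (neighbours t)

  ≉-nonmember : ∀ {t x} → (∀ j → member t j ≢ x) → ¬ t ≈ x
  ≉-nonmember x∉ (inj₁ t≡x) = x∉ 0F t≡x
  ≉-nonmember {t} x∉ (inj₂ t~x) =
    [ x∉ 1F ∘ ≡-sym , x∉ 2F ∘ ≡-sym ]′ (ExactlyTwo.only (neighbours t) t~x)

  t₀ : Fin 9
  t₀ = 0F

  t₁-fresh : ∃ λ t₁ → ∀ j → member t₀ j ≢ t₁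
  t₁-fresh = fresh (member t₀) (≤ᵇ⇒≤ 4 9 tt)

  t₁ : Fin 9
  t₁ = proj₁ t₁-fresh

  t₂-fresh : ∃ λ t₂ → ∀ j → (member t₀ ++ member t₁) j ≢ t₂
  t₂-fresh = fresh (member t₀ ++ member t₁) (≤ᵇ⇒≤ 7 9 tt)

  t₂ : Fin 9
  t₂ = proj₁ t₂-fresh

  t₀≉t₁ : ¬ t₀ ≈ t₁
  t₀≉t₁ = ≉-nonmember (proj₂ t₁-fresh)

  t₀≉t₂ : ¬ t₀ ≈ t₂
  t₀≉t₂ = ≉-nonmember λ j e →
    proj₂ t₂-fresh (j ↑ˡ 3) (trans (lookup-++ˡ (member t₀) (member t₁) j) e)

  t₁≉t₂ : ¬ t₁ ≈ t₂
  t₁≉t₂ = ≉-nonmember λ j e →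
    proj₂ t₂-fresh (3 ↑ʳ j) (trans (lookup-++ʳ (member t₀) (member t₁) j) e)

  representative : Fin 3 → Fin 9
  representative = t₀ ∷ t₁ ∷ t₂ ∷ []

  representatives-apart : ∀ {p q} → p ≢ q → ¬ representative p ≈ representative q
  representatives-apart {0F} {0F} p≢q = ⊥-elim (p≢q refl)
  representatives-apart {0F} {1F} _   = t₀≉t₁
  representatives-apart {0F} {2F} _   = t₀≉t₂
  representatives-apart {1F} {0F} _   = t₀≉t₁ ∘ ≈-sym
  representatives-apart {1F} {1F} p≢q = ⊥-elim (p≢q refl)
  representatives-apart {1F} {2F} _   = t₁≉t₂
  representatives-apart {2F} {0F} _   = t₀≉t₂ ∘ ≈-sym
  representatives-apart {2F} {1F} _   = t₁≉t₂ ∘ ≈-sym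
  representatives-apart {2F} {2F} p≢q = ⊥-elim (p≢q refl)

  embedding : Fin 9 → Fin 9
  embedding i = member (representative (part′ i)) (layer i)

  ≈-embedding : ∀ i → representative (part′ i) ≈ embedding i
  ≈-embedding i = ≈-member (representative (part′ i)) (layer i)

  embedding-apart : ∀ {i j} → part′ i ≢ part′ j → ¬ embedding i ≈ embedding j
  embedding-apart {i} {j} p≢q e =
    representatives-apart p≢q (≈-trans (≈-embedding i) (≈-trans e (≈-sym (≈-embedding j))))

  representative-member-injective : ∀ {p q x y} → p ≡ q →
                      member (representative p) x ≡ member (representative q) y → x ≡ y
  representative-member-injective {p} refl e = member-injective (representative p) e

  embedding-injective : Injective _≡_ _≡_ embedding
  embedding-injective {i} {j} e =
    [ same-part , (λ p≢q → ⊥-elim (embedding-apart {i} {j} p≢q (inj₁ e))) ]′ (Dec.toSum (part′ i ≟ part′ j))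
    where
    same-part : part′ i ≡ part′ j → i ≡ j
    same-part p≡q = part′-layer-injective p≡q
      (representative-member-injective {part′ i} {part′ j} {layer i} {layer j} p≡q e)

  rainbow-T933 : HasRainbowCopy c T933
  rainbow-T933 = rainbow-if-k₀-edges-agree T933 embedding embedding-injective
    λ {a} {b} a-b _ a~b _ →
      ⊥-elim (embedding-apart {a} {b} (λ e → a-b (parts≡ {a} {b} e)) (inj₂ a~b))
    where
    parts≡ : ∀ {a b} → part′ a ≡ part′ b → part a ≡ part b
    parts≡ {a} {b} e = trans (≡-sym (toℕ-part′ a)) (trans (cong toℕ e) (toℕ-part′ b))

lemma8 : (c : Colouring 9 28) → UsesAllColours c → ¬ HasRainbowCopy c (K 5) →
    HasRainbowCopy c T933
lemma8 c all-occur ¬rainbow = by-cases (all? λ k → 1 ≤? owners c k)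
  where
  #colours≡28 : #colours c ≡ 28
  #colours≡28 = #colours-all c all-occur
  deficit≤2 : sum (deficit c) ≤ 2
  deficit≤2 = K₉-deficit≤2 c #colours≡28 ¬rainbow
  extremal : ∀ k₀ → ¬ 1 ≤ owners c k₀ → HasRainbowCopy c T933
  extremal k₀ ¬owned = Extremal.rainbow-T933 c k₀ ¬rainbow unowned
    (λ k → single-edge-colours c deficit≤2 (all-occur k₀) unowned (all-occur k))
    (K₉-#private≡6 c #colours≡28 ¬rainbow (all-occur k₀) unowned)
    where
    unowned : owners c k₀ ≡ 0
    unowned = n≤0⇒n≡0 (≮⇒≥ ¬owned)
  by-cases : Dec (∀ k → 1 ≤ owners c k) → HasRainbowCopy c T933
  by-cases (yes owned) = ⊥-elim (¬rainbow (rainbowK5-of-small-deficit c (λ k _ → owned k)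
    (≤-trans (+-monoˡ-≤ 5 deficit≤2) (≤ᵇ⇒≤ 7 9 tt))))
  by-cases (no ¬owned) = uncurry extremal (¬∀⟶∃¬ 28 _ (λ k → 1 ≤? owners c k) ¬owned)
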